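{- Let $$H=\begin{pmatrix}3&1-2i&-1&1+2i&1\\1+2i&3&1-2i&-1&1\\-1&1+2i&3&1-2i&1\\1-2i&-1&1+2i&3&1\\1&1&1&1&1\end{pmatrix}.$$ Then $\operatorname{per}(H)=504$ and the largest eigenvalue of the $10\times10$ matrix $\mathscr{C}_2(H)$ is at least $512$; in particular $\operatorname{per}(H)$ is not the largest eigenvalue of $\mathscr{C}_2(H)$.
   Context: For an $n\times n$ complex matrix $A=(a_{ij})$, $\operatorname{per}(A)=\sum_{\sigma\in S_n}\prod_{i=1}^n a_{i\sigma(i)}$. For $I,J\subseteq[n]=\{1,\dots,n\}$, $A[I,J]$ is the submatrix with rows in $I$ and columns in $J$, and $I^c$ is the complement of $I$ in $[n]$. For $1\le k\le n$, $\mathscr{C}_k(A)$ is the $\binom nk\times\binom nk$ matrix indexed by $k$-element subsets $I,J$ of $[n]$ with $(I,J)$ entry $\operatorname{per}(A[I,J])\cdot\operatorname{per}(A[I^c,J^c])$. -}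

module Defs where

open import Data.Nat as ℕ using (ℕ; zero; suc)
open import Data.Integer as ℤ using (ℤ; +_; -[1+_])
open import Data.Rational as ℚ using (ℚ; 0ℚ; 1ℚ)
open import Data.Fin as Fin using (Fin; zero; suc)
import Data.Fin.Properties as FinP
open import Data.Fin.Subset using (Subset; ∁; ∣_∣)
open import Data.Bool using (Bool; true; false)
open import Data.Vec as Vec using (Vec; []; _∷_; lookup; toList)
open import Data.List as List using (List; []; _∷_; _++_; map; concatMap; mapMaybe; filter; foldr)
open import Data.Maybe using (Maybe; just; nothing)
open import Data.Product using (Σ; ∃; _,_; _×_; proj₁)
open import Relation.Nullary using (yes; no; ¬_)
open import Relation.Binary.PropositionalEquality using (_≡_)
import Data.List.Relation.Unary.Unique.DecPropositional as UDec

-- Gaussian rationals ℚ(i) ⊂ ℂ : re + im·i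

record ℚi : Set where
  constructor _+i_
  field
    re : ℚ
    im : ℚ
open ℚi public

infixl 6 _⊕_
infixl 7 _⊛_

_⊕_ : ℚi → ℚi → ℚi
(a +i b) ⊕ (c +i d) = (a ℚ.+ c) +i (b ℚ.+ d)

_⊛_ : ℚi → ℚi → ℚi
(a +i b) ⊛ (c +i d) = ((a ℚ.* c) ℚ.- (b ℚ.* d)) +i ((a ℚ.* d) ℚ.+ (b ℚ.* c))

0i : ℚi
0i = 0ℚ +i 0ℚ

1i : ℚi
1i = 1ℚ +i 0ℚ

ofℚ : ℚ → ℚi
ofℚ q = q +i 0ℚ

gi : ℤ → ℤ → ℚi
gi a b = (a ℚ./ 1) +i (b ℚ./ 1)

sumℚi : List ℚi → ℚi
sumℚi = foldr _⊕_ 0i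

prodℚi : List ℚi → ℚi
prodℚi = foldr _⊛_ 1i

Matrix : ℕ → Set
Matrix n = Fin n → Fin n → ℚi

allMaps : (m n : ℕ) → List (Vec (Fin n) m)
allMaps zero    n = [] ∷ []
allMaps (suc m) n = concatMap (λ v → map (_∷ v) (List.allFin n)) (allMaps m n)

permutations : (n : ℕ) → List (Vec (Fin n) n)
permutations n = filter (λ σ → UDec.unique? Fin._≟_ (toList σ)) (allMaps n n)

per : ∀ {n} → Matrix n → ℚi
per {n} A = sumℚi (map (λ σ → prodℚi (map (λ i → A i (lookup σ i)) (List.allFin n)))
                       (permutations n))

elems : ∀ {n} (p : Subset n) → Vec (Fin n) ∣ p ∣
elems []          = []
elems (false ∷ p) = Vec.map suc (elems p)
elems (true ∷ p)  = zero ∷ Vec.map suc (elems p)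

-- per(A[I,J]) (only used when |I| = |J|; 0 otherwise)
perSub : ∀ {n} → Matrix n → Subset n → Subset n → ℚi
perSub A I J with ∣ I ∣ ℕ.≟ ∣ J ∣
... | yes e = per (λ a b → A (lookup (elems I) a) (lookup (elems J) (Fin.cast e b)))
... | no _  = 0i

allSubsets : (n : ℕ) → List (Subset n)
allSubsets zero    = [] ∷ []
allSubsets (suc n) = map (false ∷_) (allSubsets n) ++ map (true ∷_) (allSubsets n)

KSub : ℕ → ℕ → Set
KSub n k = Σ (Subset n) (λ p → ∣ p ∣ ≡ k)

kSubsets : (n k : ℕ) → List (KSub n k)
kSubsets n k = mapMaybe pick (allSubsets n)
  where
  pick : Subset n → Maybe (KSub n k)
  pick p with ∣ p ∣ ℕ.≟ k
  ... | yes e = just (p , e)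
  ... | no _  = nothing

compound : ∀ {n} (k : ℕ) → Matrix n → KSub n k → KSub n k → ℚi
compound k A (I , _) (J , _) = perSub A I J ⊛ perSub A (∁ I) (∁ J)

IsEigenvalue : ∀ {n k} → (KSub n k → KSub n k → ℚi) → ℚi → Set
IsEigenvalue {n} {k} M λ′ =
  Σ (KSub n k → ℚi) λ v →
    (∃ λ I → ¬ (v I ≡ 0i)) ×
    (∀ I → sumℚi (map (λ J → M I J ⊛ v J) (kSubsets n k)) ≡ λ′ ⊛ v I)

row : ℚi → ℚi → ℚi → ℚi → ℚi → Fin 5 → ℚi
row a b c d e zero = a
row a b c d e (suc zero) = b
row a b c d e (suc (suc zero)) = c
row a b c d e (suc (suc (suc zero))) = d
row a b c d e (suc (suc (suc (suc zero)))) = e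

H : Matrix 5
H zero                         = row (gi (+ 3) (+ 0)) (gi (+ 1) (-[1+ 1 ])) (gi -[1+ 0 ] (+ 0)) (gi (+ 1) (+ 2)) (gi (+ 1) (+ 0))
H (suc zero)                   = row (gi (+ 1) (+ 2)) (gi (+ 3) (+ 0)) (gi (+ 1) (-[1+ 1 ])) (gi -[1+ 0 ] (+ 0)) (gi (+ 1) (+ 0))
H (suc (suc zero))             = row (gi -[1+ 0 ] (+ 0)) (gi (+ 1) (+ 2)) (gi (+ 3) (+ 0)) (gi (+ 1) (-[1+ 1 ])) (gi (+ 1) (+ 0))
H (suc (suc (suc zero)))       = row (gi (+ 1) (-[1+ 1 ])) (gi -[1+ 0 ] (+ 0)) (gi (+ 1) (+ 2)) (gi (+ 3) (+ 0)) (gi (+ 1) (+ 0))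
H (suc (suc (suc (suc zero)))) = row (gi (+ 1) (+ 0)) (gi (+ 1) (+ 0)) (gi (+ 1) (+ 0)) (gi (+ 1) (+ 0)) (gi (+ 1) (+ 0))

{-# OPTIONS --safe #-}
module Submission where

-- Both claims are exact computations in ℚ(i).  The leading 4×4 block of H is
-- circulant and its fifth row and column are constant, so H is invariant under
-- relabelling 1 → 2 → 3 → 4 → 1 (fixing 5) and 𝒞₂(H) commutes with the induced
-- permutation of the 2-subsets.  An eigenvector for 512 lies in the
-- (-i)-eigenspace of that permutation: v{j,5} = 2(-i)^(j-1),
-- v{j,j+1} = (-1+i)(-i)^(j-1) (indices mod 4) and v{1,3} = v{2,4} = 0.

open import Defs
open import Data.Integer using (+_; -[1+_])
open import Data.Rational using (ℚ; _≤_; _/_)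
import Data.Rational as ℚ
open import Data.Rational.Properties using (≤-refl)
open import Data.Product using (Σ; _×_; _,_)
open import Data.Bool using (true; false)
open import Data.Vec using ([]; _∷_)
open import Data.Fin.Subset using (Subset; ∁)
open import Data.List using (map)
open import Data.List.Relation.Unary.Any using (here)
open import Data.List.Relation.Unary.All as All using (All; all?)
open import Data.List.Membership.Propositional using (_∈_)
open import Data.List.Membership.Propositional.Properties using (∈-++⁺ˡ; ∈-++⁺ʳ; ∈-map⁺)
open import Relation.Nullary.Decidable using (map′; _×-dec_; from-yes; from-no)
open import Relation.Binary.Definitions using (DecidableEquality)
open import Relation.Binary.PropositionalEquality using (_≡_; refl; cong; cong₂)

infix 4 _≟ᵢ_

_≟ᵢ_ : DecidableEquality ℚi
(a +i b) ≟ᵢ (c +i d) =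
  map′ (λ (a≡c , b≡d) → cong₂ _+i_ a≡c b≡d) (λ e → cong re e , cong im e)
       (a ℚ.≟ c ×-dec b ℚ.≟ d)

∈-allSubsets : ∀ {n} (p : Subset n) → p ∈ allSubsets n
∈-allSubsets []          = here refl
∈-allSubsets (false ∷ p) = ∈-++⁺ˡ (∈-map⁺ (false ∷_) (∈-allSubsets p))
∈-allSubsets (true ∷ p)  =
  ∈-++⁺ʳ (map (false ∷_) (allSubsets _)) (∈-map⁺ (true ∷_) (∈-allSubsets p))

All-allSubsets⇒∀ : ∀ {n} {P : Subset n → Set} → All P (allSubsets n) → ∀ p → P p
All-allSubsets⇒∀ ps p = All.lookup ps (∈-allSubsets p)

per-H : per H ≡ gi (+ 504) (+ 0)
per-H = refl

μ : ℚ
μ = + 512 / 1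

v : Subset 5 → ℚi
v (true  ∷ false ∷ false ∷ false ∷ true  ∷ []) = gi (+ 2) (+ 0)
v (false ∷ true  ∷ false ∷ false ∷ true  ∷ []) = gi (+ 0) -[1+ 1 ]
v (false ∷ false ∷ true  ∷ false ∷ true  ∷ []) = gi -[1+ 1 ] (+ 0)
v (false ∷ false ∷ false ∷ true  ∷ true  ∷ []) = gi (+ 0) (+ 2)
v (true  ∷ true  ∷ false ∷ false ∷ false ∷ []) = gi -[1+ 0 ] (+ 1)
v (false ∷ true  ∷ true  ∷ false ∷ false ∷ []) = gi (+ 1) (+ 1)
v (false ∷ false ∷ true  ∷ true  ∷ false ∷ []) = gi (+ 1) -[1+ 0 ]
v (true  ∷ false ∷ false ∷ true  ∷ false ∷ []) = gi -[1+ 0 ] -[1+ 0 ]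
v _                                            = 0i

-- Defined for every subset p, not only 2-subsets: when |p| ≠ 2 every perSub H p J
-- vanishes and so does v p, so the equation below can be checked over all 32 subsets.
𝒞₂H-row·v : Subset 5 → ℚi
𝒞₂H-row·v p =
  sumℚi (map (λ (J , _) → (perSub H p J ⊛ perSub H (∁ p) (∁ J)) ⊛ v J) (kSubsets 5 2))

𝒞₂H-row·v≡μv : ∀ p → 𝒞₂H-row·v p ≡ ofℚ μ ⊛ v p
𝒞₂H-row·v≡μv = All-allSubsets⇒∀
  (from-yes (all? (λ p → 𝒞₂H-row·v p ≟ᵢ ofℚ μ ⊛ v p) (allSubsets 5)))

isEigenvalue-μ : IsEigenvalue (compound 2 H) (ofℚ μ)
isEigenvalue-μ =
    (λ (p , _) → v p)
  , (((true ∷ false ∷ false ∷ false ∷ true ∷ []) , refl) , from-no (gi (+ 2) (+ 0) ≟ᵢ 0i))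
  , λ (p , _) → 𝒞₂H-row·v≡μv p

mainTheorem3 : (per H ≡ gi (+ 504) (+ 0))
    × Σ ℚ (λ μ → (+ 512 / 1 ≤ μ) × IsEigenvalue (compound 2 H) (ofℚ μ))
mainTheorem3 = per-H , μ , ≤-refl , isEigenvalue-μ
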